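{- Let $n>d\ge0$ be integers. Then $\Delta([2,n],d)\subset\Delta(n,d)$ and $\{1,n+1\}*\Delta([2,n],d)\subset\Delta(n+1,d+2)$.
   Context: For integers $N\ge d\ge1$, a $d$-subset $F\subset[N]=\{1,\dots,N\}$ is admissible if for every integer $k\ge0$, $N-k\notin F$ implies $\{N-d+k,N-d+k+1,\dots,N-k-1\}\subset F$ (empty if $N-d+k>N-k-1$); $\Delta(N,d)$ is the simplicial complex generated by all admissible $d$-subsets of $[N]$, and $\Delta(N,0)=\{\emptyset\}$. (By a theorem of Kalai, for $N>d>0$, $\Delta(N,d)=\Delta^s(C(N,d))$, the symmetric algebraic shifting of the boundary complex of a cyclic $d$-polytope with $N$ vertices.) For a finite set $V\subset\mathbb Z$, $\Delta(V,d)$ is the image of $\Delta(|V|,d)$ under the order-preserving bijection $[|V|]\to V$; here $[2,n]=\{2,\dots,n\}$. For a set $W$ and complex $\Sigma$ on a vertex set disjoint from $W$, $W*\Sigma=\{F\cup G:F\subset W, G\in\Sigma\}$. -}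

module Defs where

open import Data.Nat using (ℕ; zero; suc; _+_; _≤_; _<_; _∸_)
open import Data.List using (List; []; _∷_; length; map; upTo; _++_)
open import Data.List.Membership.Propositional using (_∈_; _∉_)
open import Data.List.Relation.Unary.Unique.Propositional using (Unique)
open import Data.Product using (Σ; ∃; _×_)
open import Relation.Binary.PropositionalEquality using (_≡_)

-- Finite sets of integers (vertices) are represented by lists of naturals,
-- read with set semantics (membership).  Vertices are positive here anyway.
Face : Set
Face = List ℕ

_⊆ₛ_ : Face → Face → Set
F ⊆ₛ G = ∀ {x} → x ∈ F → x ∈ G

_≃ₛ_ : Face → Face → Set
F ≃ₛ G = (F ⊆ₛ G) × (G ⊆ₛ F)

Complex : Set₁
Complex = Face → Set

_⊆ᶜ_ : Complex → Complex → Set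
Σ₁ ⊆ᶜ Σ₂ = ∀ F → Σ₁ F → Σ₂ F

IsSubsetOfSize : ℕ → ℕ → Face → Set
IsSubsetOfSize N d F = Unique F × length F ≡ d × (∀ x → x ∈ F → 1 ≤ x × x ≤ N)

-- Admissibility: for every k ≥ 0, if N-k ∉ F then {N-d+k,…,N-k-1} ⊆ F.
-- Written subtraction-free: m = N - k (when N - k ≤ 0, N-k ∉ F holds trivially
-- and the interval is empty since then 2k ≥ 2N ≥ 2d > d-1, so such k impose nothing;
-- the case m = 0 is included and is likewise vacuous).
-- j ∈ {N-d+k,…,N-k-1}  ⟺  N + k ≤ j + d  and  j + k + 1 ≤ N.
Admissible : ℕ → ℕ → Face → Set
Admissible N d F =
  IsSubsetOfSize N d F ×
  (∀ k m → m + k ≡ N → m ∉ F →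
     ∀ j → N + k ≤ j + d → j + k + 1 ≤ N → j ∈ F)

Δ : ℕ → ℕ → Complex
Δ N zero    F = ∀ x → x ∉ F
Δ N (suc d) F = ∃ λ G → Admissible N (suc d) G × F ⊆ₛ G

-- The i-th element (1-indexed) of a list; used as the order-preserving
-- bijection [|V|] → V when V is listed in increasing order.
nth : List ℕ → ℕ → ℕ
nth []      _             = 0
nth (v ∷ V) zero          = 0
nth (v ∷ V) (suc zero)    = v
nth (v ∷ V) (suc (suc i)) = nth V (suc i)

-- Δ(V,d) for a finite set V listed increasingly: image of Δ(|V|,d) under
-- the order-preserving bijection [|V|] → V.
ΔV : List ℕ → ℕ → Complex
ΔV V d F = ∃ λ G → Δ (length V) d G × F ≃ₛ map (nth V) G

interval : ℕ → ℕ → List ℕ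
interval a b = map (a +_) (upTo (suc b ∸ a))

Join : Face → Complex → Complex
Join W Σ₀ H = ∃ λ F → ∃ λ G → F ⊆ₛ W × Σ₀ G × H ≃ₛ (F ++ G)

module Submission where

open import Defs
open import Data.Nat using (ℕ; zero; suc; _+_; _<_; _≤_; s≤s; z≤n; z<s)
open import Data.Nat.Properties
  using (suc-injective; +-suc; ≤-refl; +-comm; +-assoc; +-identityʳ; +-cancelˡ-≤; +-monoˡ-≤; m+n≤o⇒m≤o;
         ≤-pred; ≤-trans; ≤-<-trans; m≤m+n; m<m+n; m≤n⇒m≤1+n; n≮n; <⇒≱; ≤⇒≯; module ≤-Reasoning)
open import Data.List using ([]; _∷_; map; length; applyUpTo; upTo)
open import Data.List.Properties using (length-map; length-upTo; map-upTo)
open import Data.List.Relation.Unary.Any using (here; there)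
open import Data.List.Relation.Unary.All.Properties using (¬Any⇒All¬)
open import Data.List.Relation.Unary.AllPairs using ([]; _∷_)
import Data.List.Relation.Unary.Unique.Propositional.Properties as Unique
open import Data.List.Membership.Propositional using (_∈_; _∉_)
open import Data.List.Membership.Propositional.Properties using (∈-map⁺; ∈-map⁻)
open import Data.List.Relation.Binary.Subset.Propositional using (_⊆_)
open import Data.List.Relation.Binary.Subset.Propositional.Properties using (⊆-trans; ++⁺)
open import Data.Product using (_×_; _,_; ∃; proj₁; proj₂)
open import Function using (_∘_)
open import Relation.Nullary using (contradiction)
open import Relation.Binary.PropositionalEquality using (_≡_; refl; sym; trans; cong; subst; module ≡-Reasoning)

-- Δ([2,n],d) is Δ(n-1,d) with every vertex raised by one. Raising an admissible
-- d-subset of [n-1] by one gives an admissible d-subset of [n]; adding the two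
-- vertices 1 and n+1 to it gives an admissible (d+2)-subset of [n+1]. In both
-- cases the gap condition for a missing vertex m+1 reduces to the one for m,
-- and the remaining cases are excluded by d < n.

GapCondition : ℕ → ℕ → Face → Set
GapCondition N d F =
  ∀ k m → m + k ≡ N → m ∉ F → ∀ j → N + k ≤ j + d → j + k + 1 ≤ N → j ∈ F

gap-interval⇒k<d : ∀ {N d k j} → N + k ≤ j + d → j + k + 1 ≤ N → k < d
gap-interval⇒k<d {N} {d} {k} {j} lower upper =
  m+n≤o⇒m≤o (suc k) (+-cancelˡ-≤ j _ _ (begin
    j + (suc k + k)  ≡⟨ sym (+-assoc j (suc k) k) ⟩
    j + suc k + k    ≡⟨ cong (_+ k) (trans (+-suc j k) (+-comm 1 (j + k))) ⟩
    j + k + 1 + k    ≤⟨ +-monoˡ-≤ k upper ⟩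
    N + k            ≤⟨ lower ⟩
    j + d            ∎))
  where open ≤-Reasoning

gap-empty : ∀ {N} F → GapCondition N 0 F
gap-empty F k m _ _ j lower upper = contradiction (gap-interval⇒k<d lower upper) λ ()

Δ⇒⊆Admissible : ∀ {N} d {F} → Δ N d F → ∃ λ G → Admissible N d G × F ⊆ G
Δ⇒⊆Admissible zero    F∈Δ =
  [] , (([] , refl , λ _ ()) , gap-empty []) , λ x∈F → contradiction x∈F (F∈Δ _)
Δ⇒⊆Admissible (suc d) F∈Δ = F∈Δ

⊆Admissible⇒Δ : ∀ {N} d {F G} → Admissible N d G → F ⊆ G → Δ N d F
⊆Admissible⇒Δ zero    {G = []}    _                 F⊆[] x x∈F = contradiction (F⊆[] x∈F) λ ()
⊆Admissible⇒Δ zero    {G = _ ∷ _} ((_ , () , _) , _) _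
⊆Admissible⇒Δ (suc d) {G = G}     adm               F⊆G = G , adm , F⊆G

nth-applyUpTo : ∀ (f : ℕ → ℕ) {m i} → i < m → nth (applyUpTo f m) (suc i) ≡ f i
nth-applyUpTo f {suc m} {zero}  _         = refl
nth-applyUpTo f {suc m} {suc i} (s≤s i<m) = nth-applyUpTo (f ∘ suc) i<m

nth-interval : ∀ {N x} → 1 ≤ x × x ≤ N → nth (interval 2 (suc N)) x ≡ suc x
nth-interval {N} {suc i} (_ , i<N) = begin
  nth (map (2 +_) (upTo N)) (suc i)  ≡⟨ cong (λ V → nth V (suc i)) (map-upTo (2 +_) N) ⟩
  nth (applyUpTo (2 +_) N) (suc i)   ≡⟨ nth-applyUpTo (2 +_) i<N ⟩
  2 + i                              ∎
  where open ≡-Reasoning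

length-interval : ∀ N → length (interval 2 (suc N)) ≡ N
length-interval N = trans (length-map (2 +_) (upTo N)) (length-upTo N)

ΔV-interval⇒⊆suc-Admissible : ∀ {N d F} → ΔV (interval 2 (suc N)) d F →
  ∃ λ G → Admissible N d G × F ⊆ map suc G
ΔV-interval⇒⊆suc-Admissible {N} {d} (G , G∈Δ , F⊆nthG , _)
  with Δ⇒⊆Admissible d (subst (λ L → Δ L d G) (length-interval N) G∈Δ)
... | G₀ , adm@((_ , _ , bounds) , _) , G⊆G₀ = G₀ , adm , ⊆-trans F⊆nthG nthG⊆sucG₀
  where
  nthG⊆sucG₀ : map (nth (interval 2 (suc N))) G ⊆ map suc G₀
  nthG⊆sucG₀ x∈ with ∈-map⁻ _ x∈
  ... | y , y∈G , refl =
    subst (_∈ map suc G₀) (sym (nth-interval (bounds y (G⊆G₀ y∈G)))) (∈-map⁺ suc (G⊆G₀ y∈G))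

isSubsetOfSize-map-suc : ∀ {N d G} → IsSubsetOfSize N d G → IsSubsetOfSize (suc N) d (map suc G)
isSubsetOfSize-map-suc {G = G} (unique , size , bounds) =
  Unique.map⁺ suc-injective unique , trans (length-map suc G) size , bounds′
  where
  bounds′ : ∀ x → x ∈ map suc G → 1 ≤ x × x ≤ _
  bounds′ x x∈ with ∈-map⁻ suc x∈
  ... | y , y∈G , refl = s≤s z≤n , s≤s (proj₂ (bounds y y∈G))

gap-map-suc : ∀ {N d G} → d ≤ N → GapCondition N d G → GapCondition (suc N) d (map suc G)
gap-map-suc d≤N gap k zero refl _ j lower upper =
  contradiction (gap-interval⇒k<d lower upper) (≤⇒≯ (m≤n⇒m≤1+n d≤N))
gap-map-suc {N} d≤N gap k (suc m) _ _ zero lower _ =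
  contradiction lower (<⇒≱ (s≤s (≤-trans d≤N (m≤m+n N k))))
gap-map-suc d≤N gap k (suc m) m+k≡N m∉ (suc j) (s≤s lower) (s≤s upper) =
  ∈-map⁺ suc (gap k m (suc-injective m+k≡N) (m∉ ∘ ∈-map⁺ suc) j lower upper)

admissible-map-suc : ∀ {N d G} → d ≤ N → Admissible N d G → Admissible (suc N) d (map suc G)
admissible-map-suc d≤N (subset , gap) = isSubsetOfSize-map-suc subset , gap-map-suc d≤N gap

cone : ℕ → Face → Face
cone N G = 1 ∷ suc (suc N) ∷ map suc G

isSubsetOfSize-cone : ∀ {N d G} → IsSubsetOfSize N d G →
  IsSubsetOfSize (suc (suc N)) (suc (suc d)) (cone N G)
isSubsetOfSize-cone {N} {G = G} subset@(_ , _ , bounds)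
  with isSubsetOfSize-map-suc subset
... | unique , size , bounds′ =
  (¬Any⇒All¬ _ 1∉ ∷ ¬Any⇒All¬ _ top∉ ∷ unique) , cong (suc ∘ suc) size , bounds″
  where
  1∉ : 1 ∉ suc (suc N) ∷ map suc G
  1∉ (there 1∈) with ∈-map⁻ suc 1∈
  ... | zero , 0∈G , refl = contradiction (proj₁ (bounds 0 0∈G)) λ ()
  top∉ : suc (suc N) ∉ map suc G
  top∉ top∈ with ∈-map⁻ suc top∈
  ... | _ , y∈G , refl = contradiction (proj₂ (bounds (suc N) y∈G)) (n≮n N)
  bounds″ : ∀ x → x ∈ cone N G → 1 ≤ x × x ≤ suc (suc N)
  bounds″ _ (here refl)         = s≤s z≤n , s≤s z≤n
  bounds″ _ (there (here refl)) = s≤s z≤n , ≤-refl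
  bounds″ x (there (there x∈))  = proj₁ (bounds′ x x∈) , m≤n⇒m≤1+n (proj₂ (bounds′ x x∈))

cone-lower : ∀ {N k j d} → suc (suc N) + suc k ≤ suc j + suc (suc d) → N + k ≤ j + d
cone-lower {N} {k} {j} {d} p rewrite +-suc N k | +-suc j (suc d) | +-suc j d =
  ≤-pred (≤-pred (≤-pred p))

cone-upper : ∀ {N k j} → suc j + suc k + 1 ≤ suc (suc N) → j + k + 1 ≤ N
cone-upper {N} {k} {j} q rewrite +-suc j k = ≤-pred (≤-pred q)

gap-cone : ∀ {N d G} → d ≤ N → GapCondition N d G →
  GapCondition (suc (suc N)) (suc (suc d)) (cone N G)
gap-cone d≤N gap k zero refl _ j lower upper =
  contradiction (gap-interval⇒k<d lower upper) (≤⇒≯ (s≤s (s≤s d≤N)))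
gap-cone d≤N gap k (suc zero) _ 1∉ j _ _ = contradiction (here refl) 1∉
gap-cone d≤N gap zero (suc (suc m)) m+0≡top m∉ j _ _ =
  contradiction (there (here (trans (sym (+-identityʳ _)) m+0≡top))) m∉
gap-cone {N} d≤N gap (suc k) (suc (suc m)) _ _ zero lower _ =
  contradiction (≤-pred (≤-pred lower)) (<⇒≱ (≤-<-trans d≤N (m<m+n N z<s)))
gap-cone d≤N gap (suc k) (suc (suc m)) m+k≡top m∉ (suc j) lower upper =
  there (there (∈-map⁺ suc
    (gap k (suc m) m+k≡N (m∉ ∘ there ∘ there ∘ ∈-map⁺ suc) j (cone-lower lower) (cone-upper upper))))
  where
  m+k≡N : suc m + k ≡ _
  m+k≡N = trans (sym (+-suc m k)) (suc-injective (suc-injective m+k≡top))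

admissible-cone : ∀ {N d G} → d ≤ N → Admissible N d G →
  Admissible (suc (suc N)) (suc (suc d)) (cone N G)
admissible-cone d≤N (subset , gap) = isSubsetOfSize-cone subset , gap-cone d≤N gap

ΔV-interval⊆Δ : ∀ {N d} → d ≤ N → ΔV (interval 2 (suc N)) d ⊆ᶜ Δ (suc N) d
ΔV-interval⊆Δ {d = d} d≤N F F∈ΔV with ΔV-interval⇒⊆suc-Admissible F∈ΔV
... | G , adm , F⊆sucG = ⊆Admissible⇒Δ d (admissible-map-suc d≤N adm) F⊆sucG

join-ΔV-interval⊆Δ : ∀ {N d} → d ≤ N →
  Join (1 ∷ suc (suc N) ∷ []) (ΔV (interval 2 (suc N)) d) ⊆ᶜ Δ (suc (suc N)) (suc (suc d))
join-ΔV-interval⊆Δ {d = d} d≤N H (W , F , W⊆ends , F∈ΔV , H⊆W++F , _)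
  with ΔV-interval⇒⊆suc-Admissible F∈ΔV
... | G , adm , F⊆sucG =
  ⊆Admissible⇒Δ (suc (suc d)) (admissible-cone d≤N adm) (⊆-trans H⊆W++F (++⁺ W⊆ends F⊆sucG))

lemma4p6 : (n d : ℕ) → d < n →
    (ΔV (interval 2 n) d ⊆ᶜ Δ n d) ×
    (Join (1 ∷ suc n ∷ []) (ΔV (interval 2 n) d) ⊆ᶜ Δ (suc n) (d + 2))
lemma4p6 zero    d ()
lemma4p6 (suc N) d (s≤s d≤N) =
  ΔV-interval⊆Δ d≤N ,
  subst (λ e → Join (1 ∷ suc (suc N) ∷ []) (ΔV (interval 2 (suc N)) d) ⊆ᶜ Δ (suc (suc N)) e)
        (+-comm 2 d) (join-ΔV-interval⊆Δ d≤N)
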